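{- For $n\ge2$, $$\sum_{\pi\in\mathcal{D}_{13\text{ - }2}(n)}y^{\mu(\pi)}=y\,f_{n-2}(y),\qquad\text{where } f_n(y)=\sum_{k=0}^{\lfloor n/2\rfloor}\binom{n-k}{k}y^k .$$
   Context: Every permutation $\pi$ of $[n]=\{1,\dots,n\}$ is written in standard cycle form: each cycle is written starting with its smallest element, and the cycles are ordered from left to right by increasing first elements. The flattened form $\mathrm{flat}(\pi)$ is the word (in one-line notation) obtained by erasing the parentheses of the standard cycle form. A derangement is a permutation with no fixed points; $\mathcal{D}(n)$ is the set of derangements of $[n]$, and $\mu(\pi)$ denotes the number of cycles of $\pi$. A word $w=w_1\cdots w_n$ of distinct integers contains the vincular pattern $13\text{ - }2$ if there are indices $i$ and $k>i+1$ with $w_i<w_k<w_{i+1}$, and avoids it otherwise. $\mathcal{D}_{13\text{ - }2}(n)$ is the set of $\pi\in\mathcal{D}(n)$ such that $\mathrm{flat}(\pi)$ avoids $13\text{ - }2$. -}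

module Defs where

open import Data.Nat using (ℕ; zero; suc; _+_; _*_; _∸_; _^_; _/_)
import Data.Nat as ℕ
open import Data.Nat.Combinatorics using (_C_)
open import Data.Fin using (Fin; toℕ; _<_)
open import Data.Fin.Properties using (any?; all?; _≟_; _<?_)
open import Data.List using (List; []; _∷_; length; lookup; map; concat; concatMap; allFin; upTo; filter)
open import Data.Nat.ListAction using (sum)
open import Data.Vec as Vec using (Vec)
open import Data.Product using (Σ; ∃; _×_; _,_)
open import Data.Bool using (Bool; true; false; if_then_else_)
open import Relation.Nullary using (¬_; Dec; yes; no; does)
open import Relation.Nullary.Decidable using (_×-dec_; ¬?; _→-dec_)
open import Relation.Binary.PropositionalEquality using (_≡_; _≢_)

-- Permutations of an n-element set are taken on Fin n = {0,…,n-1}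
-- (order-isomorphic to [n]; all notions below only use the order).
-- A map Fin n → Fin n is given in one-line notation as a Vec (Fin n) n.

allVecs : (k m : ℕ) → List (Vec (Fin m) k)
allVecs zero    m = Vec.[] ∷ []
allVecs (suc k) m = concatMap (λ x → map (x Vec.∷_) (allVecs k m)) (allFin m)

-- σ is a permutation (an injective, hence bijective, self-map of Fin n)
IsPerm : ∀ {n} → Vec (Fin n) n → Set
IsPerm σ = ∀ i j → Vec.lookup σ i ≡ Vec.lookup σ j → i ≡ j

NoFix : ∀ {n} → Vec (Fin n) n → Set
NoFix σ = ∀ i → Vec.lookup σ i ≢ i

-- the cycle of σ through a, written starting at a:  a, σ a, σ² a, …
-- (fuel n suffices, since cycles have length ≤ n)
cycleFrom : ∀ {n} → Vec (Fin n) n → Fin n → List (Fin n)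
cycleFrom {n} σ a = a ∷ go n (Vec.lookup σ a)
  where
  go : ℕ → Fin n → List (Fin n)
  go zero    x = []
  go (suc f) x with does (x ≟ a)
  ... | true  = []
  ... | false = x ∷ go f (Vec.lookup σ x)

isCycleMin : ∀ {n} → Vec (Fin n) n → Fin n → Bool
isCycleMin σ a = allB (cycleFrom σ a)
  where
  allB : List _ → Bool
  allB []       = true
  allB (x ∷ xs) with does (x <? a)
  ... | true  = false
  ... | false = allB xs

-- standard cycle form: each cycle starts with its smallest element,
-- cycles ordered by increasing first (= smallest) element
cycleForm : ∀ {n} → Vec (Fin n) n → List (List (Fin n))
cycleForm {n} σ = go (allFin n)
  where
  go : List (Fin n) → List (List (Fin n))
  go []       = []
  go (a ∷ as) = if isCycleMin σ a then cycleFrom σ a ∷ go as else go as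

μ : ∀ {n} → Vec (Fin n) n → ℕ
μ σ = length (cycleForm σ)

flat : ∀ {n} → Vec (Fin n) n → List (Fin n)
flat σ = concat (cycleForm σ)

Contains13-2 : ∀ {n} → List (Fin n) → Set
Contains13-2 w =
  ∃ λ (i : Fin (length w)) → ∃ λ (i' : Fin (length w)) → ∃ λ (k : Fin (length w)) →
    (toℕ i' ≡ suc (toℕ i)) × (suc (toℕ i) ℕ.< toℕ k) ×
    (lookup w i < lookup w k) × (lookup w k < lookup w i')

Avoids13-2 : ∀ {n} → List (Fin n) → Set
Avoids13-2 w = ¬ Contains13-2 w

InD13-2 : ∀ {n} → Vec (Fin n) n → Set
InD13-2 σ = IsPerm σ × NoFix σ × Avoids13-2 (flat σ)

InD13-2? : ∀ {n} (σ : Vec (Fin n) n) → Dec (InD13-2 σ)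
InD13-2? σ =
  all? (λ i → all? (λ j → (Vec.lookup σ i ≟ Vec.lookup σ j) →-dec (i ≟ j)))
  ×-dec (all? (λ i → ¬? (Vec.lookup σ i ≟ i)))
  ×-dec ¬? (any? (λ i → any? (λ i' → any? (λ k →
           (toℕ i' ℕ.≟ suc (toℕ i)) ×-dec (suc (toℕ i) ℕ.<? toℕ k) ×-dec
           (lookup (flat σ) i <? lookup (flat σ) k) ×-dec
           (lookup (flat σ) k <? lookup (flat σ) i')))))

D13-2 : (n : ℕ) → List (Vec (Fin n) n)
D13-2 n = filter InD13-2? (allVecs n n)

cyclePoly : (n y : ℕ) → ℕ
cyclePoly n y = sum (map (λ σ → y ^ μ σ) (D13-2 n))

f : (n y : ℕ) → ℕ
f n y = sum (map (λ k → ((n ∸ k) C k) * y ^ k) (upTo (suc (n / 2))))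

module Submission where

-- A derangement whose flattened cycle form avoids 13-2 has intervals of consecutive integers as
-- its cycles.  Suppose the cycles covering [0, t) are intervals.  Then t is the least element of
-- its cycle, which therefore comes right after them in flat π, and it runs t, t+1, t+2, …: if
-- π^(i+1)(t) exceeded t+i+1, the value t+i+1 would occur later in flat π and form a 13-2 with the
-- adjacent entries π^i(t), π^(i+1)(t).  Conversely the permutation whose cycles are consecutive
-- intervals of lengths ≥ 2 has flat form 0 1 … n-1.  Hence D_{13-2}(n) corresponds to the
-- compositions of n into parts ≥ 2, with μ the number of parts.  The generating polynomial G of
-- these compositions satisfies G(k+2) = y G(k) + G(k+1) (the first part is 2, or larger), and
-- y f_k satisfies the same recursion by Pascal's rule.

open import Defs
open import Data.Nat using (ℕ; _≤_; _*_; _∸_)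
open import Relation.Binary.PropositionalEquality using (_≡_)

open import Algebra.Properties.CommutativeSemigroup using (interchange)
open import Data.Bool using (true; false; if_then_else_; T)
open import Data.Empty using (⊥-elim)
open import Data.Fin as Fin using (Fin; toℕ; fromℕ<)
import Data.Fin.Properties as Fin
open import Data.List
  using (List; []; _∷_; _++_; map; concat; concatMap; length; allFin; filterᵇ; cartesianProductWith; upTo)
import Data.List as List
open import Data.List.Extrema.Nat using (argmin; argmin-sel; f[argmin]≤f[xs])
open import Data.List.Membership.Propositional using (_∈_; _∉_)
open import Data.List.Membership.Propositional.Properties
  using (∈-map⁺; ∈-map⁻; ∈-filter⁺; ∈-filter⁻; ∈-concat⁺′; ∈-concat⁻′; ∈-allFin; ∈-++⁻; ∈-++⁺ˡ; ∈-++⁺ʳ;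
         ∈-cartesianProductWith⁺)
open import Data.List.Membership.Propositional.Properties.WithK using (unique∧set⇒bag)
open import Data.List.Properties
  using (++-identityʳ; ++-assoc; ∷-injective; length-map; length-iterate; map-∘; map-++; map-cong; map-cong-local;
         map-applyUpTo; concat-map; concat-++; upTo-∷ʳ; filter-++; filter-accept; filter-none)
open import Data.List.Relation.Binary.BagAndSetEquality using (∼bag⇒↭)
open import Data.List.Relation.Binary.Permutation.Propositional using (_↭_)
import Data.List.Relation.Binary.Permutation.Propositional.Properties as ↭
open import Data.List.Relation.Unary.All as All using (All; []; _∷_)
import Data.List.Relation.Unary.All.Properties as All
import Data.List.Relation.Unary.Any as Any
open import Data.List.Relation.Unary.Any using (here; there)
open import Data.List.Relation.Unary.Any.Properties using (lookup-index)
open import Data.List.Relation.Unary.Unique.Propositional using (Unique; []; _∷_)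
import Data.List.Relation.Unary.Unique.Propositional.Properties as Unique
open import Data.Nat
  using (suc; zero; pred; _+_; _^_; _<_; _<?_; _≤?_; z≤n; s≤s; s≤s⁻¹; z<s; s<s; NonZero; >-nonZero; _%_; _/_)
open import Data.Nat.Combinatorics using (_C_; k>n⇒nCk≡0; nCk+nC[k+1]≡[n+1]C[k+1])
open import Data.Nat.DivMod using (m≡m%n+[m/n]*n; m%n<n; m/n≤m)
open import Data.Nat.GeneralisedArithmetic using (iterate)
open import Data.Nat.Induction using (<-wellFounded)
open import Data.Nat.ListAction using (sum)
open import Data.Nat.ListAction.Properties using (sum-++; sum-↭)
open import Data.Nat.Properties
open import Data.Nat.Tactic.RingSolver using (solve-∀)
open import Data.Product using (∃; _×_; _,_; proj₁; proj₂)
open import Data.Sum using (_⊎_; inj₁; inj₂; [_,_]′)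
open import Data.Unit using (tt)
open import Data.Vec as Vec using (Vec; lookup; tabulate)
open import Data.Vec.Properties as Vec using (lookup∘tabulate; tabulate∘lookup; tabulate-cong)
open import Function using (_∘_; id)
open import Function.Bundles using (mk⇔)
open import Induction.WellFounded using (Acc; acc)
open import Relation.Binary.Definitions using (tri<; tri≈; tri>)
open import Relation.Binary.PropositionalEquality
  using (_≢_; refl; sym; trans; cong; cong₂; subst; subst₂; module ≡-Reasoning)
open import Relation.Nullary using (¬_; Dec; yes; no; does)
open import Relation.Nullary.Decidable using (¬?; T?; dec-true; dec-false)

open ≡-Reasoning

module _ {a} {A : Set a} (f : A → A) where

  iterate-suc : ∀ x k → iterate f x (suc k) ≡ f (iterate f x k)
  iterate-suc x zero    = refl
  iterate-suc x (suc k) = iterate-suc (f x) k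

  iterate-+ : ∀ x j k → iterate f x (j + k) ≡ iterate f (iterate f x j) k
  iterate-+ x zero    k = refl
  iterate-+ x (suc j) k = iterate-+ (f x) j k

  iterate-periodic : ∀ {x ℓ} → iterate f x ℓ ≡ x → ∀ q → iterate f x (q * ℓ) ≡ x
  iterate-periodic         ret zero    = refl
  iterate-periodic {x} {ℓ} ret (suc q) = begin
    iterate f x (ℓ + q * ℓ)           ≡⟨ iterate-+ x ℓ (q * ℓ) ⟩
    iterate f (iterate f x ℓ) (q * ℓ) ≡⟨ cong (λ z → iterate f z (q * ℓ)) ret ⟩
    iterate f x (q * ℓ)               ≡⟨ iterate-periodic ret q ⟩
    x                                 ∎

  iterate-% : ∀ {x ℓ} .{{_ : NonZero ℓ}} → iterate f x ℓ ≡ x → ∀ k → iterate f x k ≡ iterate f x (k % ℓ)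
  iterate-% {x} {ℓ} ret k = begin
    iterate f x k                                 ≡⟨ cong (iterate f x) (trans (m≡m%n+[m/n]*n k ℓ) (+-comm (k % ℓ) _)) ⟩
    iterate f x ((k / ℓ) * ℓ + k % ℓ)             ≡⟨ iterate-+ x ((k / ℓ) * ℓ) (k % ℓ) ⟩
    iterate f (iterate f x ((k / ℓ) * ℓ)) (k % ℓ) ≡⟨ cong (λ z → iterate f z (k % ℓ)) (iterate-periodic ret (k / ℓ)) ⟩
    iterate f x (k % ℓ)                           ∎

  ∈-iterate⁺ : ∀ x {i k} → i < k → iterate f x i ∈ List.iterate f x k
  ∈-iterate⁺ x {zero}  {suc k} _         = here refl
  ∈-iterate⁺ x {suc i} {suc k} (s≤s i<k) = there (∈-iterate⁺ (f x) i<k)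

  ∈-iterate⁻ : ∀ x k {z} → z ∈ List.iterate f x k → ∃ λ i → i < k × z ≡ iterate f x i
  ∈-iterate⁻ x (suc k) (here refl) = 0 , z<s , refl
  ∈-iterate⁻ x (suc k) (there z∈) with ∈-iterate⁻ (f x) k z∈
  ... | i , i<k , refl = suc i , s<s i<k , refl

  iterate-++ : ∀ x j k → List.iterate f x (j + k) ≡ List.iterate f x j ++ List.iterate f (iterate f x j) k
  iterate-++ x zero    k = refl
  iterate-++ x (suc j) k = cong (x ∷_) (iterate-++ (f x) j k)

  map-iterate : ∀ {b} {B : Set b} (g : A → B) {h : B → B} x y k →
                (∀ {i} → i < k → g (iterate f x i) ≡ iterate h y i) →
                map g (List.iterate f x k) ≡ List.iterate h y k
  map-iterate g x y zero    _     = refl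
  map-iterate g x y (suc k) g≡h = cong₂ _∷_ (g≡h z<s) (map-iterate g (f x) _ k (λ i<k → g≡h (s<s i<k)))

least : ∀ {p} {P : ℕ → Set p} → (∀ k → Dec (P k)) → ∀ {m} → P m →
        ∃ λ k → k ≤ m × P k × (∀ {i} → i < k → ¬ P i)
least {P = P} P? {m} Pm = search 0 m Pm (λ ())
  where
  search : ∀ s d → P (s + d) → (∀ {i} → i < s → ¬ P i) → ∃ λ k → k ≤ s + d × P k × (∀ {i} → i < k → ¬ P i)
  search s d Ps+d below with P? s
  ... | yes Ps = s , m≤m+n s d , Ps , below
  search s zero    Ps+d below | no ¬Ps = ⊥-elim (¬Ps (subst P (+-identityʳ s) Ps+d))
  search s (suc d) Ps+d below | no ¬Ps =
    let k , k≤ , Pk , min = search (suc s) d (subst P (+-suc s d) Ps+d) below′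
    in k , ≤-trans k≤ (≤-reflexive (sym (+-suc s d))) , Pk , min
    where
    below′ : ∀ {i} → i < suc s → ¬ P i
    below′ i<1+s with m≤n⇒m<n∨m≡n (s≤s⁻¹ i<1+s)
    ... | inj₁ i<s  = below i<s
    ... | inj₂ refl = ¬Ps

map-++⁻ : ∀ {a b} {A : Set a} {B : Set b} (f : A → B) xs {ys zs} → map f xs ≡ ys ++ zs →
          ∃ λ xs₁ → ∃ λ xs₂ → xs ≡ xs₁ ++ xs₂ × map f xs₁ ≡ ys × map f xs₂ ≡ zs
map-++⁻ f xs       {[]}     refl = [] , xs , refl , refl , refl
map-++⁻ f (x ∷ xs) {y ∷ ys} eq with refl , eq′ ← ∷-injective eq
  = let xs₁ , xs₂ , xs≡ , eq₁ , eq₂ = map-++⁻ f xs eq′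
    in x ∷ xs₁ , xs₂ , cong (x ∷_) xs≡ , cong (f x ∷_) eq₁ , eq₂

map⁺-injectiveOn : ∀ {a b} {A : Set a} {B : Set b} {f : A → B} {xs} →
                   (∀ {x y} → x ∈ xs → y ∈ xs → f x ≡ f y → x ≡ y) → Unique xs → Unique (map f xs)
map⁺-injectiveOn inj []           = []
map⁺-injectiveOn inj (x∉xs ∷ uxs) =
  All.map⁺ (All.tabulate (λ y∈ fx≡fy → All.lookup x∉xs y∈ (inj (here refl) (there y∈) fx≡fy))) ∷
  map⁺-injectiveOn (λ x∈ y∈ → inj (there x∈) (there y∈)) uxs

concatMap-map≡cartesianProductWith : ∀ {a b c} {A : Set a} {B : Set b} {C : Set c} (f : A → B → C) xs ys →
                                     concatMap (λ x → map (f x) ys) xs ≡ cartesianProductWith f xs ys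
concatMap-map≡cartesianProductWith f []       ys = refl
concatMap-map≡cartesianProductWith f (x ∷ xs) ys = cong (map (f x) ys ++_) (concatMap-map≡cartesianProductWith f xs ys)

sum-map-+ : ∀ {a} {A : Set a} (g h : A → ℕ) xs → sum (map (λ x → g x + h x) xs) ≡ sum (map g xs) + sum (map h xs)
sum-map-+ g h []       = refl
sum-map-+ g h (x ∷ xs) = trans (cong (g x + h x +_) (sum-map-+ g h xs)) (interchange +-commutativeSemigroup (g x) (h x) _ _)

sum-map-*ˡ : ∀ {a} {A : Set a} y (g : A → ℕ) xs → sum (map (λ x → y * g x) xs) ≡ y * sum (map g xs)
sum-map-*ˡ y g []       = sym (*-zeroʳ y)
sum-map-*ˡ y g (x ∷ xs) = trans (cong (y * g x +_) (sum-map-*ˡ y g xs)) (sym (*-distribˡ-+ y (g x) _))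

sum-map-upTo-suc : ∀ (g : ℕ → ℕ) N → sum (map g (upTo (suc N))) ≡ g 0 + sum (map (g ∘ suc) (upTo N))
sum-map-upTo-suc g N = cong (λ xs → g 0 + sum xs) (trans (map-applyUpTo suc g N) (sym (map-applyUpTo id (g ∘ suc) N)))

sum-map-upTo-vanishing : ∀ (g : ℕ → ℕ) {N} → (∀ {i} → N ≤ i → g i ≡ 0) → ∀ {M} → N ≤ M →
                         sum (map g (upTo M)) ≡ sum (map g (upTo N))
sum-map-upTo-vanishing g {N} vanish {M} N≤M with m≤n⇒∃[o]m+o≡n N≤M
... | d , refl = extend d
  where
  extend : ∀ d → sum (map g (upTo (N + d))) ≡ sum (map g (upTo N))
  extend zero    = cong (sum ∘ map g ∘ upTo) (+-identityʳ N)
  extend (suc d) = begin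
    sum (map g (upTo (N + suc d)))               ≡⟨ cong (sum ∘ map g ∘ upTo) (+-suc N d) ⟩
    sum (map g (upTo (suc (N + d))))             ≡⟨ cong (sum ∘ map g) (upTo-∷ʳ (N + d)) ⟨
    sum (map g (upTo (N + d) ++ N + d ∷ []))     ≡⟨ cong sum (map-++ g (upTo (N + d)) _) ⟩
    sum (map g (upTo (N + d)) ++ g (N + d) ∷ []) ≡⟨ sum-++ (map g (upTo (N + d))) _ ⟩
    sum (map g (upTo (N + d))) + (g (N + d) + 0) ≡⟨ cong (λ z → sum (map g (upTo (N + d))) + (z + 0)) (vanish (m≤m+n N d)) ⟩
    sum (map g (upTo (N + d))) + 0               ≡⟨ +-identityʳ _ ⟩
    sum (map g (upTo (N + d)))                   ≡⟨ extend d ⟩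
    sum (map g (upTo N))                         ∎

-- Intervals and the pattern 13-2

interval : ℕ → ℕ → List ℕ
interval s k = List.iterate suc s k

iterate-suc≡+ : ∀ s i → iterate suc s i ≡ s + i
iterate-suc≡+ s zero    = sym (+-identityʳ s)
iterate-suc≡+ s (suc i) = trans (iterate-suc≡+ (suc s) i) (sym (+-suc s i))

interval-++ : ∀ s j k → interval s (j + k) ≡ interval s j ++ interval (s + j) k
interval-++ s j k = trans (iterate-++ suc s j k) (cong (λ s′ → interval s j ++ interval s′ k) (iterate-suc≡+ s j))

∈-interval⁻ : ∀ {s k v} → v ∈ interval s k → ∃ λ i → i < k × v ≡ s + i
∈-interval⁻ {s} {k} v∈ = let i , i<k , v≡ = ∈-iterate⁻ suc s k v∈ in i , i<k , trans v≡ (iterate-suc≡+ s i)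

map-toℕ-allFin : ∀ n → map toℕ (allFin n) ≡ interval 0 n
map-toℕ-allFin n = shifted 0 id (λ _ → refl)
  where
  shifted : ∀ {k} s (g : Fin k → Fin n) → (∀ i → toℕ (g i) ≡ s + toℕ i) → map toℕ (List.tabulate g) ≡ interval s k
  shifted {zero}  s g g≡ = refl
  shifted {suc k} s g g≡ = cong₂ _∷_ (trans (g≡ Fin.zero) (+-identityʳ s))
                                     (shifted (suc s) (g ∘ Fin.suc) (λ i → trans (g≡ (Fin.suc i)) (+-suc s (toℕ i))))

toℕ-lookup-interval : ∀ {n s m} (w : List (Fin n)) → map toℕ w ≡ interval s m →
                      ∀ i → toℕ (List.lookup w i) ≡ s + toℕ i
toℕ-lookup-interval {s = s} {suc m} (x ∷ w) eq Fin.zero    = trans (proj₁ (∷-injective eq)) (sym (+-identityʳ s))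
toℕ-lookup-interval {s = s} {suc m} (x ∷ w) eq (Fin.suc i) =
  trans (toℕ-lookup-interval w (proj₂ (∷-injective eq)) i) (sym (+-suc s (toℕ i)))

increasing⇒avoids13-2 : ∀ {n} (w : List (Fin n)) →
                        (∀ {i j} → toℕ i < toℕ j → List.lookup w i Fin.< List.lookup w j) → Avoids13-2 w
increasing⇒avoids13-2 w increasing (i , i′ , k , i′≡1+i , 1+i<k , _ , wₖ<wᵢ′) =
  <-asym wₖ<wᵢ′ (increasing (subst (_< toℕ k) (sym i′≡1+i) 1+i<k))

contains13-2 : ∀ {n} (pre : List (Fin n)) {u v x} post → x ∉ pre → x ∈ pre ++ u ∷ v ∷ post →
               u Fin.< x → x Fin.< v → Contains13-2 (pre ++ u ∷ v ∷ post)
contains13-2 []        post _ (here x≡u)         u<x _   = ⊥-elim (<-irrefl (cong toℕ (sym x≡u)) u<x)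
contains13-2 []        post _ (there (here x≡v)) _   x<v = ⊥-elim (<-irrefl (cong toℕ x≡v) x<v)
contains13-2 []        post _ (there (there x∈)) u<x x<v =
  Fin.zero , Fin.suc Fin.zero , Fin.suc (Fin.suc (Any.index x∈)) , refl , s≤s (s≤s z≤n) ,
  subst (_ Fin.<_) (lookup-index x∈) u<x , subst (Fin._< _) (lookup-index x∈) x<v
contains13-2 (_ ∷ pre) post x∉ (here x≡y)  _   _   = ⊥-elim (x∉ (here x≡y))
contains13-2 (_ ∷ pre) post x∉ (there x∈) u<x x<v with contains13-2 pre post (x∉ ∘ there) x∈ u<x x<v
... | i , i′ , k , i′≡1+i , 1+i<k , wᵢ<wₖ , wₖ<wᵢ′ =
  Fin.suc i , Fin.suc i′ , Fin.suc k , cong suc i′≡1+i , s<s 1+i<k , wᵢ<wₖ , wₖ<wᵢ′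

walkUntil : ∀ {n} → Vec (Fin n) n → Fin n → ℕ → Fin n → List (Fin n)
walkUntil σ a zero    x = []
walkUntil σ a (suc f) x = if does (x Fin.≟ a) then [] else x ∷ walkUntil σ a f (lookup σ x)

-- The local functions of cycleFrom, isCycleMin and cycleForm cannot be named outside Defs.  In each
-- mutual block below the helper's left-hand side is a metavariable, solved by the first declaration
-- once `with` has turned the arguments of the local function into variables.
mutual
  cycleFrom-walkUntil : ∀ {n} (σ : Vec (Fin n) n) a → cycleFrom σ a ≡ a ∷ walkUntil σ a n (lookup σ a)
  cycleFrom-walkUntil {suc m} σ a with lookup σ a
  ... | x with does (x Fin.≟ a)
  ... | true  = refl
  ... | false with lookup σ x
  ... | y with suc m
  ... | _ = cong (λ ys → a ∷ x ∷ ys) (go≡walkUntil σ a m y)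

  go≡walkUntil : ∀ {n} (σ : Vec (Fin n) n) a f x → _ ≡ walkUntil σ a f x
  go≡walkUntil σ a zero    x = refl
  go≡walkUntil σ a (suc f) x with does (x Fin.≟ a)
  ... | true  = refl
  ... | false = cong (x ∷_) (go≡walkUntil σ a f (lookup σ x))

mutual
  isCycleMin-all? : ∀ {n} (σ : Vec (Fin n) n) a →
                    isCycleMin σ a ≡ does (All.all? (λ x → ¬? (x Fin.<? a)) (cycleFrom σ a))
  isCycleMin-all? {suc m} σ a rewrite go≡walkUntil σ a (suc m) (lookup σ a)
    with walkUntil σ a (suc m) (lookup σ a)
  ... | ys with does (a Fin.<? a)
  ... | true  = refl
  ... | false with suc m
  ... | _ = allB≡all? σ a ys

  allB≡all? : ∀ {n} (σ : Vec (Fin n) n) a xs → _ ≡ does (All.all? (λ x → ¬? (x Fin.<? a)) xs)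
  allB≡all? σ a []       = refl
  allB≡all? σ a (x ∷ xs) with does (x Fin.<? a)
  ... | true  = refl
  ... | false = allB≡all? σ a xs

cycleStarts : ∀ {n} → Vec (Fin n) n → List (Fin n)
cycleStarts {n} σ = filterᵇ (isCycleMin σ) (allFin n)

mutual
  cycleForm-cycleStarts : ∀ {n} (σ : Vec (Fin n) n) → cycleForm σ ≡ map (cycleFrom σ) (cycleStarts σ)
  cycleForm-cycleStarts {n} σ with allFin n
  ... | as = go≡map σ as

  go≡map : ∀ {n} (σ : Vec (Fin n) n) as → _ ≡ map (cycleFrom σ) (filterᵇ (isCycleMin σ) as)
  go≡map σ []       = refl
  go≡map σ (a ∷ as) with isCycleMin σ a
  ... | true  = cong (cycleFrom σ a ∷_) (go≡map σ as)
  ... | false = go≡map σ as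

module _ {n} (σ : Vec (Fin n) n) where

  isCycleMin-true : ∀ a → All (a Fin.≤_) (cycleFrom σ a) → isCycleMin σ a ≡ true
  isCycleMin-true a a≤cycle =
    trans (isCycleMin-all? σ a) (dec-true (All.all? _ (cycleFrom σ a)) (All.map ≤⇒≯ a≤cycle))

  isCycleMin-false : ∀ {a z} → z ∈ cycleFrom σ a → z Fin.< a → isCycleMin σ a ≡ false
  isCycleMin-false {a} z∈ z<a =
    trans (isCycleMin-all? σ a) (dec-false (All.all? _ (cycleFrom σ a)) (λ ≮a → All.lookup ≮a z∈ z<a))

  ∈-cycleStarts⁺ : ∀ {a} → isCycleMin σ a ≡ true → a ∈ cycleStarts σ
  ∈-cycleStarts⁺ {a} isMin = ∈-filter⁺ (T? ∘ isCycleMin σ) (∈-allFin a) (subst T (sym isMin) tt)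

  flat-cycleStarts : flat σ ≡ concat (map (cycleFrom σ) (cycleStarts σ))
  flat-cycleStarts = cong concat (cycleForm-cycleStarts σ)

-- Cycles of a permutation

module Cycles {n : ℕ} (σ : Vec (Fin n) n) where

  σ^ : ℕ → Fin n → Fin n
  σ^ k x = iterate (lookup σ) x k

  orbit : ℕ → Fin n → List (Fin n)
  orbit k x = List.iterate (lookup σ) x k

  record MinimalPeriod (x : Fin n) (ℓ : ℕ) : Set where
    field
      positive : 0 < ℓ
      returns  : σ^ ℓ x ≡ x
      minimal  : ∀ {i} → 0 < i → i < ℓ → σ^ i x ≢ x

  walkUntil-self : ∀ f a → walkUntil σ a f a ≡ []
  walkUntil-self zero    a = refl
  walkUntil-self (suc f) a with a Fin.≟ a
  ... | yes _  = refl
  ... | no a≢a = ⊥-elim (a≢a refl)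

  walkUntil-orbit : ∀ k f a x → k ≤ f → (∀ {i} → i < k → σ^ i x ≢ a) →
                    walkUntil σ a f x ≡ orbit k x ++ walkUntil σ a (f ∸ k) (σ^ k x)
  walkUntil-orbit zero    f       a x _         _     = refl
  walkUntil-orbit (suc k) (suc f) a x (s≤s k≤f) avoid with x Fin.≟ a
  ... | yes x≡a = ⊥-elim (avoid z<s x≡a)
  ... | no  _   = cong (x ∷_) (walkUntil-orbit k f a (lookup σ x) k≤f (λ i<k → avoid (s<s i<k)))

  cycleFrom-orbit : ∀ {x ℓ} → MinimalPeriod x ℓ → ℓ ≤ n → cycleFrom σ x ≡ orbit ℓ x
  cycleFrom-orbit {x} {suc k} per ℓ≤n = begin
    cycleFrom σ x                         ≡⟨ cycleFrom-walkUntil σ x ⟩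
    x ∷ walkUntil σ x n (lookup σ x)      ≡⟨ cong (x ∷_) (walkUntil-orbit k n x (lookup σ x) (<⇒≤ ℓ≤n) noReturn) ⟩
    x ∷ (later ++ rest (σ^ (suc k) x))    ≡⟨ cong (λ z → x ∷ (later ++ rest z)) returns ⟩
    x ∷ (later ++ rest x)                 ≡⟨ cong (λ ys → x ∷ (later ++ ys)) (walkUntil-self (n ∸ k) x) ⟩
    x ∷ (later ++ [])                     ≡⟨ cong (x ∷_) (++-identityʳ later) ⟩
    orbit (suc k) x                       ∎
    where
    open MinimalPeriod per
    later : List (Fin n)
    later = orbit k (lookup σ x)
    rest = walkUntil σ x (n ∸ k)
    noReturn : ∀ {i} → i < k → σ^ i (lookup σ x) ≢ x
    noReturn i<k = minimal z<s (s<s i<k)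

  cycleFrom-split : ∀ {x ℓ i} → MinimalPeriod x ℓ → ℓ ≤ n → suc i < ℓ →
                    ∃ λ R → cycleFrom σ x ≡ orbit i x ++ σ^ i x ∷ σ^ (suc i) x ∷ R
  cycleFrom-split {x} {ℓ} {i} per ℓ≤n 1+i<ℓ with m≤n⇒∃[o]m+o≡n 1+i<ℓ
  ... | r , 2+i+r≡ℓ = R , (begin
    cycleFrom σ x                               ≡⟨ cycleFrom-orbit per ℓ≤n ⟩
    orbit ℓ x                                   ≡⟨ cong (λ k → orbit k x) ℓ≡ ⟩
    orbit (i + suc (suc r)) x                   ≡⟨ iterate-++ (lookup σ) x i (suc (suc r)) ⟩
    orbit i x ++ σ^ i x ∷ lookup σ (σ^ i x) ∷ R ≡⟨ cong (λ y → orbit i x ++ σ^ i x ∷ y ∷ R) (iterate-suc (lookup σ) x i) ⟨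
    orbit i x ++ σ^ i x ∷ σ^ (suc i) x ∷ R      ∎)
    where
    R = List.iterate (lookup σ) (lookup σ (lookup σ (σ^ i x))) r
    ℓ≡ : ℓ ≡ i + suc (suc r)
    ℓ≡ = sym (trans (trans (+-suc i (suc r)) (cong suc (+-suc i r))) 2+i+r≡ℓ)

  module _ (σ-injective : IsPerm σ) where

    σ^-cancel : ∀ i d x → σ^ i x ≡ σ^ (i + d) x → x ≡ σ^ d x
    σ^-cancel zero    d x eq = eq
    σ^-cancel (suc i) d x eq = σ-injective x (σ^ d x) (begin
      lookup σ x        ≡⟨ σ^-cancel i d (lookup σ x) eq ⟩
      σ^ (suc d) x      ≡⟨ iterate-suc (lookup σ) x d ⟩
      lookup σ (σ^ d x) ∎)

    returnTime : ∀ x → ∃ λ d → 0 < d × d ≤ n × σ^ d x ≡ x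
    returnTime x with Fin.pigeonhole (n<1+n n) (λ (j : Fin (suc n)) → σ^ (toℕ j) x)
    ... | i , j , i<j , σⁱx≡σʲx =
      toℕ j ∸ toℕ i , m<n⇒0<n∸m i<j , ≤-trans (m∸n≤m (toℕ j) (toℕ i)) (s≤s⁻¹ (Fin.toℕ<n j)) ,
      sym (σ^-cancel (toℕ i) (toℕ j ∸ toℕ i) x
             (trans σⁱx≡σʲx (cong (λ k → σ^ k x) (sym (m+[n∸m]≡n (<⇒≤ i<j))))))

    minimalPeriod : ∀ x → ∃ λ ℓ → ℓ ≤ n × MinimalPeriod x ℓ
    minimalPeriod x with returnTime x
    ... | suc m , _ , d≤n , ret with least (λ k → σ^ (suc k) x Fin.≟ x) ret
    ...   | k , k≤m , ret′ , below = suc k , ≤-trans (s≤s k≤m) d≤n , record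
      { positive = z<s
      ; returns  = ret′
      ; minimal  = λ { {suc i} _ (s≤s i<k) → below i<k }
      }

    σ^-collision : ∀ {x ℓ i j} → MinimalPeriod x ℓ → i < j → j < ℓ → σ^ i x ≢ σ^ j x
    σ^-collision {x} {i = i} {j} per i<j j<ℓ eq =
      minimal (m<n⇒0<n∸m i<j) (≤-<-trans (m∸n≤m j i) j<ℓ)
        (sym (σ^-cancel i (j ∸ i) x (trans eq (cong (λ k → σ^ k x) (sym (m+[n∸m]≡n (<⇒≤ i<j)))))))
      where open MinimalPeriod per

    σ^-injective : ∀ {x ℓ i j} → MinimalPeriod x ℓ → i < ℓ → j < ℓ → σ^ i x ≡ σ^ j x → i ≡ j
    σ^-injective {i = i} {j} per i<ℓ j<ℓ eq with <-cmp i j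
    ... | tri< i<j _ _ = ⊥-elim (σ^-collision per i<j j<ℓ eq)
    ... | tri≈ _ i≡j _ = i≡j
    ... | tri> _ _ j<i = ⊥-elim (σ^-collision per j<i i<ℓ (sym eq))

    ∈-cycleFrom⁺ : ∀ k x → σ^ k x ∈ cycleFrom σ x
    ∈-cycleFrom⁺ k x with minimalPeriod x
    ... | ℓ@(suc _) , ℓ≤n , per =
      subst₂ _∈_ (sym (iterate-% (lookup σ) returns k)) (sym (cycleFrom-orbit per ℓ≤n))
        (∈-iterate⁺ (lookup σ) x (m%n<n k ℓ))
      where open MinimalPeriod per

    ∈-cycleFrom⁻ : ∀ {x z} → z ∈ cycleFrom σ x → ∃ λ k → z ≡ σ^ k x
    ∈-cycleFrom⁻ {x} {z} z∈ with minimalPeriod x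
    ... | ℓ , ℓ≤n , per with ∈-iterate⁻ (lookup σ) x ℓ (subst (z ∈_) (cycleFrom-orbit per ℓ≤n) z∈)
    ...   | k , _ , z≡σᵏx = k , z≡σᵏx

    cycleFrom-trans : ∀ {x y z} → y ∈ cycleFrom σ x → z ∈ cycleFrom σ y → z ∈ cycleFrom σ x
    cycleFrom-trans {x} y∈ z∈ with ∈-cycleFrom⁻ y∈ | ∈-cycleFrom⁻ z∈
    ... | j , refl | i , refl = subst (_∈ cycleFrom σ x) (iterate-+ (lookup σ) x j i) (∈-cycleFrom⁺ (j + i) x)

    cycleFrom-sym : ∀ {x y} → y ∈ cycleFrom σ x → x ∈ cycleFrom σ y
    cycleFrom-sym {x} y∈ with ∈-cycleFrom⁻ y∈ | minimalPeriod x
    ... | j , refl | ℓ@(suc _) , _ , per = subst (_∈ cycleFrom σ (σ^ j x)) back (∈-cycleFrom⁺ (j * ℓ ∸ j) (σ^ j x))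
      where
      open MinimalPeriod per
      back : σ^ (j * ℓ ∸ j) (σ^ j x) ≡ x
      back = begin
        σ^ (j * ℓ ∸ j) (σ^ j x) ≡⟨ iterate-+ (lookup σ) x j (j * ℓ ∸ j) ⟨
        σ^ (j + (j * ℓ ∸ j)) x  ≡⟨ cong (λ k → σ^ k x) (m+[n∸m]≡n (m≤m*n j ℓ)) ⟩
        σ^ (j * ℓ) x            ≡⟨ iterate-periodic (lookup σ) returns j ⟩
        x                       ∎

    ∈-flat : ∀ x → x ∈ flat σ
    ∈-flat x = subst (x ∈_) (sym (flat-cycleStarts σ))
      (∈-concat⁺′ (cycleFrom-sym m∈cycle) (∈-map⁺ (cycleFrom σ) (∈-cycleStarts⁺ σ m-isCycleMin)))
      where
      cycle = cycleFrom σ x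
      m = argmin toℕ x cycle
      m∈cycle : m ∈ cycle
      m∈cycle = [ (λ m≡x → subst (_∈ cycle) (sym m≡x) (here refl)) , id ]′ (argmin-sel toℕ x cycle)
      m-isCycleMin : isCycleMin σ m ≡ true
      m-isCycleMin = isCycleMin-true σ m
        (All.tabulate (λ z∈ → All.lookup (f[argmin]≤f[xs] {f = toℕ} x cycle) (cycleFrom-trans m∈cycle z∈)))

-- Block permutations

cyclicSucc : ℕ → ℕ → ℕ
cyclicSucc p i with suc i <? p
... | yes _ = suc i
... | no  _ = 0

cyclicSucc-< : ∀ {p i} → suc i < p → cyclicSucc p i ≡ suc i
cyclicSucc-< {p} {i} 1+i<p with suc i <? p
... | yes _     = refl
... | no  1+i≮p = ⊥-elim (1+i≮p 1+i<p)

cyclicSucc-last : ∀ i → cyclicSucc (suc i) i ≡ 0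
cyclicSucc-last i with suc i <? suc i
... | yes 1+i<1+i = ⊥-elim (<-irrefl refl 1+i<1+i)
... | no  _       = refl

cyclicSucc-bounded : ∀ {p i} → i < p → cyclicSucc p i < p
cyclicSucc-bounded {p} {i} i<p with suc i <? p
... | yes 1+i<p = 1+i<p
... | no  _     = ≤-<-trans z≤n i<p

cyclicSucc-≢ : ∀ {p} i → 2 ≤ p → cyclicSucc p i ≢ i
cyclicSucc-≢ {p} i 2≤p with suc i <? p
... | yes _ = 1+n≢n
cyclicSucc-≢ zero    2≤p | no 1≮p = λ _ → 1≮p 2≤p
cyclicSucc-≢ (suc i) _   | no _   = λ ()

cyclicSucc-injective : ∀ {p i j} → i < p → j < p → cyclicSucc p i ≡ cyclicSucc p j → i ≡ j
cyclicSucc-injective {p} {i} {j} i<p j<p eq with suc i <? p | suc j <? p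
... | yes _   | yes _   = suc-injective eq
... | yes _   | no  _   = ⊥-elim (1+n≢0 eq)
... | no  _   | yes _   = ⊥-elim (1+n≢0 (sym eq))
... | no  i≮p | no  j≮p = ≤-antisym (s≤s⁻¹ (≤-trans i<p (≮⇒≥ j≮p))) (s≤s⁻¹ (≤-trans j<p (≮⇒≥ i≮p)))

cyclicSucc-surjective : ∀ {p v} → v < p → ∃ λ u → u < p × cyclicSucc p u ≡ v
cyclicSucc-surjective {suc p} {zero}  _   = p , n<1+n p , cyclicSucc-last p
cyclicSucc-surjective {p}     {suc v} v<p = v , <-trans (n<1+n v) v<p , cyclicSucc-< v<p

data BlockView (p : ℕ) : ℕ → Set where
  inside : ∀ {k} → k < p → BlockView p k
  beyond : ∀ k → BlockView p (p + k)

blockView : ∀ p k → BlockView p k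
blockView p k with k <? p
... | yes k<p = inside k<p
... | no  k≮p with m≤n⇒∃[o]m+o≡n (≮⇒≥ k≮p)
...   | k′ , refl = beyond k′

blockSucc : List ℕ → ℕ → ℕ
blockSucc []      k = k
blockSucc (p ∷ c) k with k <? p
... | yes _ = cyclicSucc p k
... | no  _ = p + blockSucc c (k ∸ p)

blockSucc-inside : ∀ {p k} c → k < p → blockSucc (p ∷ c) k ≡ cyclicSucc p k
blockSucc-inside {p} {k} c k<p with k <? p
... | yes _   = refl
... | no  k≮p = ⊥-elim (k≮p k<p)

blockSucc-beyond : ∀ p c k → blockSucc (p ∷ c) (p + k) ≡ p + blockSucc c k
blockSucc-beyond p c k with p + k <? p
... | yes p+k<p = ⊥-elim (<⇒≱ p+k<p (m≤m+n p k))
... | no  _     = cong (λ k′ → p + blockSucc c k′) (m+n∸m≡n p k)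

blockSucc-inside-< : ∀ {p k} c → k < p → blockSucc (p ∷ c) k < p
blockSucc-inside-< c k<p = subst (_< _) (sym (blockSucc-inside c k<p)) (cyclicSucc-bounded k<p)

blockSucc-beyond-≥ : ∀ p c k → p ≤ blockSucc (p ∷ c) (p + k)
blockSucc-beyond-≥ p c k = subst (p ≤_) (sym (blockSucc-beyond p c k)) (m≤m+n p _)

blockSucc-bounded : ∀ c {k} → k < sum c → blockSucc c k < sum c
blockSucc-bounded (p ∷ c) {k} k<sum with blockView p k
... | inside k<p = <-≤-trans (blockSucc-inside-< c k<p) (m≤m+n p (sum c))
... | beyond k′  =
  subst (_< p + sum c) (sym (blockSucc-beyond p c k′)) (+-monoʳ-< p (blockSucc-bounded c (+-cancelˡ-< p _ _ k<sum)))

blockSucc-≢ : ∀ {c k} → All (2 ≤_) c → k < sum c → blockSucc c k ≢ k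
blockSucc-≢ {p ∷ c} {k} (2≤p ∷ _) _ with blockView p k
... | inside k<p = cyclicSucc-≢ k 2≤p ∘ trans (sym (blockSucc-inside c k<p))
blockSucc-≢ {p ∷ c} (_ ∷ parts≥2) k<sum | beyond k′ =
  blockSucc-≢ parts≥2 (+-cancelˡ-< p _ _ k<sum) ∘ +-cancelˡ-≡ p _ _ ∘ trans (sym (blockSucc-beyond p c k′))

blockSucc-injective : ∀ c {j k} → j < sum c → k < sum c → blockSucc c j ≡ blockSucc c k → j ≡ k
blockSucc-injective (p ∷ c) {j} {k} j<sum k<sum eq with blockView p j | blockView p k
... | inside j<p | inside k<p =
  cyclicSucc-injective j<p k<p (trans (sym (blockSucc-inside c j<p)) (trans eq (blockSucc-inside c k<p)))
... | inside j<p | beyond k′ = ⊥-elim (<⇒≱ (blockSucc-inside-< c j<p) (subst (p ≤_) (sym eq) (blockSucc-beyond-≥ p c k′)))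
... | beyond j′ | inside k<p = ⊥-elim (<⇒≱ (blockSucc-inside-< c k<p) (subst (p ≤_) eq (blockSucc-beyond-≥ p c j′)))
... | beyond j′ | beyond k′ = cong (p +_) (blockSucc-injective c (+-cancelˡ-< p _ _ j<sum) (+-cancelˡ-< p _ _ k<sum)
  (+-cancelˡ-≡ p _ _ (trans (sym (blockSucc-beyond p c j′)) (trans eq (blockSucc-beyond p c k′)))))

blockSucc-surjective : ∀ c {v} → v < sum c → ∃ λ k → k < sum c × blockSucc c k ≡ v
blockSucc-surjective (p ∷ c) {v} v<sum with blockView p v
... | inside v<p =
  let u , u<p , eq = cyclicSucc-surjective v<p
  in u , <-≤-trans u<p (m≤m+n p (sum c)) , trans (blockSucc-inside c u<p) eq
... | beyond v′ =
  let u , u<sum , eq = blockSucc-surjective c (+-cancelˡ-< p _ _ v<sum)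
  in p + u , +-monoʳ-< p u<sum , trans (blockSucc-beyond p c u) (cong (p +_) eq)

blockSucc-++ˡ : ∀ c d {k} → k < sum c → blockSucc (c ++ d) k ≡ blockSucc c k
blockSucc-++ˡ (p ∷ c) d {k} k<sum with blockView p k
... | inside k<p = trans (blockSucc-inside (c ++ d) k<p) (sym (blockSucc-inside c k<p))
... | beyond k′  = begin
  blockSucc (p ∷ c ++ d) (p + k′) ≡⟨ blockSucc-beyond p (c ++ d) k′ ⟩
  p + blockSucc (c ++ d) k′       ≡⟨ cong (p +_) (blockSucc-++ˡ c d (+-cancelˡ-< p _ _ k<sum)) ⟩
  p + blockSucc c k′              ≡⟨ blockSucc-beyond p c k′ ⟨
  blockSucc (p ∷ c) (p + k′)      ∎

blockSucc-++ʳ : ∀ c d k → blockSucc (c ++ d) (sum c + k) ≡ sum c + blockSucc d k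
blockSucc-++ʳ []      d k = refl
blockSucc-++ʳ (p ∷ c) d k = begin
  blockSucc (p ∷ c ++ d) (p + sum c + k)   ≡⟨ cong (blockSucc (p ∷ c ++ d)) (+-assoc p (sum c) k) ⟩
  blockSucc (p ∷ c ++ d) (p + (sum c + k)) ≡⟨ blockSucc-beyond p (c ++ d) (sum c + k) ⟩
  p + blockSucc (c ++ d) (sum c + k)       ≡⟨ cong (p +_) (blockSucc-++ʳ c d k) ⟩
  p + (sum c + blockSucc d k)              ≡⟨ +-assoc p (sum c) (blockSucc d k) ⟨
  p + sum c + blockSucc d k                ∎

Composition≥2 : ℕ → List ℕ → Set
Composition≥2 n c = All (2 ≤_) c × sum c ≡ n

-- The default d is a junk value, returned only when k ≥ n.
toFin : ∀ {n} → Fin n → ℕ → Fin n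
toFin {n} d k with k <? n
... | yes k<n = fromℕ< k<n
... | no  _   = d

toℕ-toFin : ∀ {n} (d : Fin n) {k} → k < n → toℕ (toFin d k) ≡ k
toℕ-toFin {n} d {k} k<n with k <? n
... | yes _   = Fin.toℕ-fromℕ< k<n
... | no  k≮n = ⊥-elim (k≮n k<n)

blockPerm : ∀ {n} → List ℕ → Vec (Fin n) n
blockPerm c = tabulate (λ x → toFin x (blockSucc c (toℕ x)))

toℕ<sum : ∀ {n} c → sum c ≡ n → (x : Fin n) → toℕ x < sum c
toℕ<sum c sum≡n x = subst (toℕ x <_) (sym sum≡n) (Fin.toℕ<n x)

toℕ-lookup-blockPerm : ∀ {n} c → sum c ≡ n → ∀ x → toℕ (lookup (blockPerm {n} c) x) ≡ blockSucc c (toℕ x)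
toℕ-lookup-blockPerm c sum≡n x = trans (cong toℕ (lookup∘tabulate _ x))
  (toℕ-toFin x (subst (blockSucc c (toℕ x) <_) sum≡n (blockSucc-bounded c (toℕ<sum c sum≡n x))))

ActsAsBlocks : ∀ {n} → Vec (Fin n) n → List ℕ → ℕ → Set
ActsAsBlocks σ c t = ∀ x k → toℕ x ≡ t + k → k < sum c → toℕ (lookup σ x) ≡ t + blockSucc c k

actsAsBlocks-tail : ∀ {n} {σ : Vec (Fin n) n} {p c t} → ActsAsBlocks σ (p ∷ c) t → ActsAsBlocks σ c (t + p)
actsAsBlocks-tail {σ = σ} {p} {c} {t} acts x k x≡ k<sum = begin
  toℕ (lookup σ x)              ≡⟨ acts x (p + k) (trans x≡ (+-assoc t p k)) (+-monoʳ-< p k<sum) ⟩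
  t + blockSucc (p ∷ c) (p + k) ≡⟨ cong (t +_) (blockSucc-beyond p c k) ⟩
  t + (p + blockSucc c k)       ≡⟨ +-assoc t p (blockSucc c k) ⟨
  t + p + blockSucc c k         ∎

intervals : ℕ → List ℕ → List (List ℕ)
intervals t []      = []
intervals t (p ∷ c) = interval t p ∷ intervals (t + p) c

length-intervals : ∀ t c → length (intervals t c) ≡ length c
length-intervals t []      = refl
length-intervals t (p ∷ c) = cong suc (length-intervals (t + p) c)

map-length-intervals : ∀ t c → map length (intervals t c) ≡ c
map-length-intervals t []      = refl
map-length-intervals t (p ∷ c) = cong₂ _∷_ (length-iterate suc t p) (map-length-intervals (t + p) c)

concat-intervals : ∀ t c → concat (intervals t c) ≡ interval t (sum c)
concat-intervals t []      = refl
concat-intervals t (p ∷ c) = begin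
  interval t p ++ concat (intervals (t + p) c) ≡⟨ cong (interval t p ++_) (concat-intervals (t + p) c) ⟩
  interval t p ++ interval (t + p) (sum c)     ≡⟨ interval-++ t p (sum c) ⟨
  interval t (p + sum c)                       ∎

module BlockCycles {n : ℕ} (σ : Vec (Fin n) n) (σ-injective : IsPerm σ) where
  open Cycles σ

  module FirstBlock {q c t} (acts : ActsAsBlocks σ (suc q ∷ c) t) (bound : t + suc q ≤ n)
                    (a : Fin n) (a≡t : toℕ a ≡ t) where

    σ^-first : ∀ {i} → i < suc q → toℕ (σ^ i a) ≡ t + i
    σ^-first {zero}  _     = trans a≡t (sym (+-identityʳ t))
    σ^-first {suc i} 1+i<1+q = begin
      toℕ (σ^ (suc i) a)           ≡⟨ cong toℕ (iterate-suc (lookup σ) a i) ⟩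
      toℕ (lookup σ (σ^ i a))      ≡⟨ acts (σ^ i a) i (σ^-first i<1+q) (<-≤-trans i<1+q (m≤m+n (suc q) (sum c))) ⟩
      t + blockSucc (suc q ∷ c) i  ≡⟨ cong (t +_) (trans (blockSucc-inside c i<1+q) (cyclicSucc-< 1+i<1+q)) ⟩
      t + suc i                    ∎
      where i<1+q = <-trans (n<1+n i) 1+i<1+q

    period : MinimalPeriod a (suc q)
    period = record
      { positive = z<s
      ; returns  = Fin.toℕ-injective (begin
          toℕ (σ^ (suc q) a)          ≡⟨ cong toℕ (iterate-suc (lookup σ) a q) ⟩
          toℕ (lookup σ (σ^ q a))     ≡⟨ acts (σ^ q a) q (σ^-first (n<1+n q)) (<-≤-trans (n<1+n q) (m≤m+n (suc q) (sum c))) ⟩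
          t + blockSucc (suc q ∷ c) q ≡⟨ cong (t +_) (trans (blockSucc-inside c (n<1+n q)) (cyclicSucc-last q)) ⟩
          t + 0                       ≡⟨ +-identityʳ t ⟩
          t                           ≡⟨ a≡t ⟨
          toℕ a                       ∎)
      ; minimal  = λ {i} 0<i i<1+q σⁱa≡a → <⇒≢ 0<i (sym (+-cancelˡ-≡ t i 0
          (trans (sym (σ^-first i<1+q)) (trans (cong toℕ σⁱa≡a) (trans a≡t (sym (+-identityʳ t)))))))
      }

    cycleFrom-first : map toℕ (cycleFrom σ a) ≡ interval t (suc q)
    cycleFrom-first = begin
      map toℕ (cycleFrom σ a)   ≡⟨ cong (map toℕ) (cycleFrom-orbit period (≤-trans (m≤n+m (suc q) t) bound)) ⟩
      map toℕ (orbit (suc q) a) ≡⟨ map-iterate (lookup σ) toℕ a t (suc q) (λ {i} i<1+q → trans (σ^-first i<1+q) (sym (iterate-suc≡+ t i))) ⟩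
      interval t (suc q)        ∎

    first-isCycleMin : isCycleMin σ a ≡ true
    first-isCycleMin = isCycleMin-true σ a (All.tabulate a≤)
      where
      a≤ : ∀ {z} → z ∈ cycleFrom σ a → a Fin.≤ z
      a≤ {z} z∈ with ∈-interval⁻ (subst (toℕ z ∈_) cycleFrom-first (∈-map⁺ toℕ z∈))
      ... | i , _ , z≡t+i = subst₂ _≤_ (sym a≡t) (sym z≡t+i) (m≤m+n t i)

    inner-isCycleMin : ∀ {X i} → toℕ X ≡ t + suc i → suc i < suc q → isCycleMin σ X ≡ false
    inner-isCycleMin {X} {i} X≡ 1+i<1+q = isCycleMin-false σ
      (cycleFrom-sym σ-injective (subst (_∈ cycleFrom σ a) σⁱa≡X (∈-cycleFrom⁺ σ-injective (suc i) a)))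
      (subst₂ _<_ (sym a≡t) (sym X≡) (m<m+n t z<s))
      where
      σⁱa≡X : σ^ (suc i) a ≡ X
      σⁱa≡X = Fin.toℕ-injective (trans (σ^-first 1+i<1+q) (sym X≡))

  cycles-intervals : ∀ c {t} xs → All (2 ≤_) c → ActsAsBlocks σ c t → t + sum c ≤ n →
                     map toℕ xs ≡ interval t (sum c) →
                     map (map toℕ ∘ cycleFrom σ) (filterᵇ (isCycleMin σ) xs) ≡ intervals t c
  cycles-intervals []              []  _                 _    _     _   = refl
  cycles-intervals (p@(suc q) ∷ c) {t} xs (_ ∷ parts≥2) acts bound xs≡
    with map-++⁻ toℕ xs {interval t p} (trans xs≡ (interval-++ t p (sum c)))
  ... | a ∷ inner , rest , refl , first≡ , rest≡ = begin
    map g (filterᵇ P ((a ∷ inner) ++ rest))         ≡⟨ cong (map g) (filter-++ (T? ∘ P) (a ∷ inner) rest) ⟩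
    map g (filterᵇ P (a ∷ inner) ++ filterᵇ P rest) ≡⟨ cong (λ as → map g (as ++ filterᵇ P rest)) startsOfFirst ⟩
    g a ∷ map g (filterᵇ P rest)                    ≡⟨ cong₂ _∷_ cycleFrom-first
                                                         (cycles-intervals c rest parts≥2 acts′ bound′ rest≡) ⟩
    interval t p ∷ intervals (t + p) c              ∎
    where
    g = map toℕ ∘ cycleFrom σ
    P = isCycleMin σ
    acts′ = actsAsBlocks-tail {σ = σ} acts
    bound′ : t + p + sum c ≤ n
    bound′ = ≤-trans (≤-reflexive (+-assoc t p (sum c))) bound
    open FirstBlock {q} {c} {t} acts (≤-trans (+-monoʳ-≤ t (m≤m+n p (sum c))) bound) a (proj₁ (∷-injective first≡))
    notStart : ∀ {X} → X ∈ inner → ¬ T (P X)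
    notStart {X} X∈ with ∈-interval⁻ (subst (toℕ X ∈_) (proj₂ (∷-injective first≡)) (∈-map⁺ toℕ X∈))
    ... | i , i<q , X≡ = subst T (inner-isCycleMin (trans X≡ (sym (+-suc t i))) (s<s i<q))
    startsOfFirst : filterᵇ P (a ∷ inner) ≡ a ∷ []
    startsOfFirst = trans (filter-accept (T? ∘ P) (subst T (sym first-isCycleMin) tt))
                          (cong (a ∷_) (filter-none (T? ∘ P) (All.tabulate notStart)))

module BlockPerm {n c} (comp : Composition≥2 n c) where

  private
    parts≥2 = proj₁ comp
    sum≡n   = proj₂ comp
    <sum    = toℕ<sum c sum≡n
    toℕ-σ   = toℕ-lookup-blockPerm c sum≡n

  σ : Vec (Fin n) n
  σ = blockPerm c

  isPerm : IsPerm σ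
  isPerm x y eq = Fin.toℕ-injective
    (blockSucc-injective c (<sum x) (<sum y) (trans (sym (toℕ-σ x)) (trans (cong toℕ eq) (toℕ-σ y))))

  noFix : NoFix σ
  noFix x eq = blockSucc-≢ parts≥2 (<sum x) (trans (sym (toℕ-σ x)) (cong toℕ eq))

  cycleForm-intervals : map (map toℕ) (cycleForm σ) ≡ intervals 0 c
  cycleForm-intervals = begin
    map (map toℕ) (cycleForm σ)                       ≡⟨ cong (map (map toℕ)) (cycleForm-cycleStarts σ) ⟩
    map (map toℕ) (map (cycleFrom σ) (cycleStarts σ)) ≡⟨ map-∘ (cycleStarts σ) ⟨
    map (map toℕ ∘ cycleFrom σ) (cycleStarts σ)       ≡⟨ BlockCycles.cycles-intervals σ isPerm c (allFin n) parts≥2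
                                                           acts (≤-reflexive sum≡n) allFin≡ ⟩
    intervals 0 c                                     ∎
    where
    acts : ActsAsBlocks σ c 0
    acts x k x≡k _ = trans (toℕ-σ x) (cong (blockSucc c) x≡k)
    allFin≡ : map toℕ (allFin n) ≡ interval 0 (sum c)
    allFin≡ = trans (map-toℕ-allFin n) (cong (interval 0) (sym sum≡n))

  μ-blockPerm : μ σ ≡ length c
  μ-blockPerm = begin
    length (cycleForm σ)                 ≡⟨ length-map (map toℕ) (cycleForm σ) ⟨
    length (map (map toℕ) (cycleForm σ)) ≡⟨ cong length cycleForm-intervals ⟩
    length (intervals 0 c)               ≡⟨ length-intervals 0 c ⟩
    length c                             ∎

  flat-blockPerm : map toℕ (flat σ) ≡ interval 0 n
  flat-blockPerm = begin
    map toℕ (concat (cycleForm σ))       ≡⟨ concat-map (cycleForm σ) ⟨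
    concat (map (map toℕ) (cycleForm σ)) ≡⟨ cong concat cycleForm-intervals ⟩
    concat (intervals 0 c)               ≡⟨ concat-intervals 0 c ⟩
    interval 0 (sum c)                   ≡⟨ cong (interval 0) sum≡n ⟩
    interval 0 n                         ∎

  blockPerm-∈D13-2 : InD13-2 σ
  blockPerm-∈D13-2 = isPerm , noFix , increasing⇒avoids13-2 (flat σ) (λ {i} {j} → subst₂ _<_ (sym (value i)) (sym (value j)))
    where value = toℕ-lookup-interval (flat σ) flat-blockPerm

  blockPerm-parts : map length (map (map toℕ) (cycleForm σ)) ≡ c
  blockPerm-parts = trans (cong (map length) cycleForm-intervals) (map-length-intervals 0 c)

blockPerm-injective : ∀ {n c c′} → Composition≥2 n c → Composition≥2 n c′ →
                      blockPerm {n} c ≡ blockPerm c′ → c ≡ c′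
blockPerm-injective {n} {c} {c′} comp comp′ eq = begin
  c                                                         ≡⟨ BlockPerm.blockPerm-parts comp ⟨
  map length (map (map toℕ) (cycleForm (blockPerm {n} c)))  ≡⟨ cong (map length ∘ map (map toℕ) ∘ cycleForm) eq ⟩
  map length (map (map toℕ) (cycleForm (blockPerm {n} c′))) ≡⟨ BlockPerm.blockPerm-parts comp′ ⟩
  c′                                                        ∎

-- Decomposition of D_{13-2}(n) into blocks

module Decomposition {n : ℕ} (σ : Vec (Fin n) n) (σ-injective : IsPerm σ) (noFix : NoFix σ)
                     (avoids : Avoids13-2 (flat σ)) where
  open Cycles σ

  module AfterPrefix {c} (acts : ActsAsBlocks σ c 0) (t<n : sum c < n) where

    t : ℕ
    t = sum c

    σ-below : ∀ {x} → toℕ x < t → toℕ (lookup σ x) < t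
    σ-below {x} x<t = subst (_< t) (sym (acts x (toℕ x) refl x<t)) (blockSucc-bounded c x<t)

    σ-above : ∀ {x} → t ≤ toℕ x → t ≤ toℕ (lookup σ x)
    σ-above {x} t≤x with toℕ (lookup σ x) <? t
    ... | no  σx≮t = ≮⇒≥ σx≮t
    ... | yes σx<t with blockSucc-surjective c σx<t
    ...   | u , u<t , u↦σx = ⊥-elim (<⇒≱ (subst (_< t) (cong toℕ U≡x) U<t) t≤x)
      where
      U = fromℕ< (<-trans u<t t<n)
      U<t : toℕ U < t
      U<t = subst (_< t) (sym (Fin.toℕ-fromℕ< _)) u<t
      U≡x : U ≡ x
      U≡x = σ-injective U x (Fin.toℕ-injective (trans (acts U u (Fin.toℕ-fromℕ< _) u<t) u↦σx))

    σ^-below : ∀ k {x} → toℕ x < t → toℕ (σ^ k x) < t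
    σ^-below zero    x<t = x<t
    σ^-below (suc k) x<t = σ^-below k (σ-below x<t)

    σ^-above : ∀ k {x} → t ≤ toℕ x → t ≤ toℕ (σ^ k x)
    σ^-above zero    t≤x = t≤x
    σ^-above (suc k) t≤x = σ^-above k (σ-above t≤x)

    a : Fin n
    a = fromℕ< t<n

    a≡t : toℕ a ≡ t
    a≡t = Fin.toℕ-fromℕ< t<n

    allFin-split : ∃ λ L₁ → ∃ λ L₂ → allFin n ≡ L₁ ++ a ∷ L₂ × All (λ b → toℕ b < t) L₁
    allFin-split with map-++⁻ toℕ (allFin n) {interval 0 t}
                        (trans (map-toℕ-allFin n) (trans (cong (interval 0) (sym n≡)) (interval-++ 0 t _)))
      where n≡ = trans (+-suc t (n ∸ suc t)) (m+[n∸m]≡n t<n)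
    ... | L₁ , a′ ∷ L₂ , allFin≡ , L₁≡ , a′∷L₂≡ =
      L₁ , L₂ , trans allFin≡ (cong (λ b → L₁ ++ b ∷ L₂) a′≡a) , All.tabulate below
      where
      a′≡a = Fin.toℕ-injective (trans (proj₁ (∷-injective a′∷L₂≡)) (sym a≡t))
      below : ∀ {b} → b ∈ L₁ → toℕ b < t
      below b∈ = let i , i<t , b≡i = ∈-interval⁻ (subst (_ ∈_) L₁≡ (∈-map⁺ toℕ b∈)) in subst (_< t) (sym b≡i) i<t

    a-isCycleMin : isCycleMin σ a ≡ true
    a-isCycleMin = isCycleMin-true σ a (All.tabulate (λ z∈ →
      let k , z≡ = ∈-cycleFrom⁻ σ-injective z∈
      in subst₂ _≤_ (sym a≡t) (cong toℕ (sym z≡)) (σ^-above k (≤-reflexive (sym a≡t)))))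

    flat-split : ∃ λ A → ∃ λ B → flat σ ≡ A ++ cycleFrom σ a ++ B × All (λ z → toℕ z < t) A
    flat-split with allFin-split
    ... | L₁ , L₂ , allFin≡ , L₁<t = C₁ , C₂ , flat≡ , All.tabulate below
      where
      P = isCycleMin σ
      C₁ = concat (map (cycleFrom σ) (filterᵇ P L₁))
      C₂ = concat (map (cycleFrom σ) (filterᵇ P L₂))
      cycles = concat ∘ map (cycleFrom σ)
      flat≡ : flat σ ≡ C₁ ++ cycleFrom σ a ++ C₂
      flat≡ = begin
        flat σ                                       ≡⟨ flat-cycleStarts σ ⟩
        cycles (filterᵇ P (allFin n))                ≡⟨ cong (cycles ∘ filterᵇ P) allFin≡ ⟩
        cycles (filterᵇ P (L₁ ++ a ∷ L₂))            ≡⟨ cong cycles (filter-++ (T? ∘ P) L₁ (a ∷ L₂)) ⟩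
        cycles (filterᵇ P L₁ ++ filterᵇ P (a ∷ L₂))  ≡⟨ cong (λ as → cycles (filterᵇ P L₁ ++ as))
                                                          (filter-accept (T? ∘ P) (subst T (sym a-isCycleMin) tt)) ⟩
        cycles (filterᵇ P L₁ ++ a ∷ filterᵇ P L₂)    ≡⟨ cong concat (map-++ (cycleFrom σ) (filterᵇ P L₁) _) ⟩
        concat (map (cycleFrom σ) (filterᵇ P L₁) ++ map (cycleFrom σ) (a ∷ filterᵇ P L₂))
                                                     ≡⟨ concat-++ (map (cycleFrom σ) (filterᵇ P L₁)) _ ⟨
        C₁ ++ cycleFrom σ a ++ C₂                    ∎
      below : ∀ {z} → z ∈ C₁ → toℕ z < t
      below z∈ with ∈-concat⁻′ (map (cycleFrom σ) (filterᵇ P L₁)) z∈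
      ... | _ , z∈cyc , cyc∈ with ∈-map⁻ (cycleFrom σ) cyc∈
      ...   | b , b∈ , refl with ∈-cycleFrom⁻ σ-injective z∈cyc
      ...     | k , refl = σ^-below k (All.lookup L₁<t (proj₁ (∈-filter⁻ (T? ∘ P) b∈)))

  module NextBlock {c} (acts : ActsAsBlocks σ c 0) (t<n : sum c < n)
                   {ℓ} (ℓ≤n : ℓ ≤ n) (period : MinimalPeriod (fromℕ< t<n) ℓ) where
    open AfterPrefix {c} acts t<n
    open MinimalPeriod period

    2≤ℓ : 2 ≤ ℓ
    2≤ℓ = ≤∧≢⇒< positive (λ 1≡ℓ → noFix a (subst (λ k → σ^ k a ≡ a) (sym 1≡ℓ) returns))

    ConsecutiveUpTo : ℕ → Set
    ConsecutiveUpTo i = ∀ {j} → j ≤ i → toℕ (σ^ j a) ≡ t + j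

    -- t + i + 1 lies outside the cycles before a and the part of a's cycle up to σ^i a, so it
    -- occurs after σ^(i+1) a in flat σ.
    jump⇒13-2 : ∀ {i} → suc i < ℓ → ConsecutiveUpTo i → t + suc i < toℕ (σ^ (suc i) a) → Contains13-2 (flat σ)
    jump⇒13-2 {i} 1+i<ℓ upToI jump = located flat-split (cycleFrom-split period ℓ≤n 1+i<ℓ)
      where
      U = σ^ i a
      V = σ^ (suc i) a
      X = fromℕ< (<-trans jump (Fin.toℕ<n V))
      X≡ : toℕ X ≡ t + suc i
      X≡ = Fin.toℕ-fromℕ< _
      U<X : U Fin.< X
      U<X = subst₂ _<_ (sym (upToI ≤-refl)) (sym X≡) (+-monoʳ-< t (n<1+n i))
      X<V : X Fin.< V
      X<V = subst (_< toℕ V) (sym X≡) jump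
      notInOrbit : X ∉ orbit i a
      notInOrbit X∈ = let j , j<i , X≡σʲa = ∈-iterate⁻ (lookup σ) a i X∈ in
        <⇒≢ (<-trans j<i (n<1+n i))
          (+-cancelˡ-≡ t j (suc i) (trans (sym (upToI (<⇒≤ j<i))) (trans (cong toℕ (sym X≡σʲa)) X≡)))
      located : (∃ λ A → ∃ λ B → flat σ ≡ A ++ cycleFrom σ a ++ B × All (λ z → toℕ z < t) A) →
                (∃ λ R → cycleFrom σ a ≡ orbit i a ++ U ∷ V ∷ R) → Contains13-2 (flat σ)
      located (A , B , flat≡ , A<t) (R , cycle≡) = subst Contains13-2 (sym flat≡′)
        (contains13-2 (A ++ orbit i a) (R ++ B) notBefore (subst (X ∈_) flat≡′ (∈-flat σ-injective X)) U<X X<V)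
        where
        flat≡′ : flat σ ≡ (A ++ orbit i a) ++ U ∷ V ∷ (R ++ B)
        flat≡′ = begin
          flat σ                               ≡⟨ flat≡ ⟩
          A ++ cycleFrom σ a ++ B              ≡⟨ cong (λ cyc → A ++ cyc ++ B) cycle≡ ⟩
          A ++ (orbit i a ++ U ∷ V ∷ R) ++ B   ≡⟨ cong (A ++_) (++-assoc (orbit i a) (U ∷ V ∷ R) B) ⟩
          A ++ orbit i a ++ U ∷ V ∷ (R ++ B)   ≡⟨ ++-assoc A (orbit i a) _ ⟨
          (A ++ orbit i a) ++ U ∷ V ∷ (R ++ B) ∎
        notBefore : X ∉ A ++ orbit i a
        notBefore X∈ = [ (λ X∈A → <⇒≱ (All.lookup A<t X∈A) (subst (t ≤_) (sym X≡) (m≤m+n t (suc i)))) , notInOrbit ]′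
                         (∈-++⁻ A X∈)

    noJump : ∀ {i} → suc i < ℓ → ConsecutiveUpTo i → toℕ (σ^ (suc i) a) ≤ t + suc i
    noJump 1+i<ℓ upToI = ≮⇒≥ (avoids ∘ jump⇒13-2 1+i<ℓ upToI)

    noGap : ∀ {i} → suc i < ℓ → ConsecutiveUpTo i → t + suc i ≤ toℕ (σ^ (suc i) a)
    noGap {i} 1+i<ℓ upToI = ≮⇒≥ repeats
      where
      V = σ^ (suc i) a
      t≤V : t ≤ toℕ V
      t≤V = σ^-above (suc i) (≤-reflexive (sym a≡t))
      repeats : ¬ (toℕ V < t + suc i)
      repeats gap = <⇒≱ (s≤s j≤i) (≤-reflexive (σ^-injective σ-injective period 1+i<ℓ j<ℓ V≡σʲa))
        where
        j≤i : toℕ V ∸ t ≤ i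
        j≤i = s≤s⁻¹ (subst (toℕ V ∸ t <_) (m+n∸m≡n t (suc i)) (∸-monoˡ-< gap t≤V))
        j<ℓ : toℕ V ∸ t < ℓ
        j<ℓ = ≤-<-trans j≤i (<-trans (n<1+n i) 1+i<ℓ)
        V≡σʲa : V ≡ σ^ (toℕ V ∸ t) a
        V≡σʲa = Fin.toℕ-injective (trans (sym (m+[n∸m]≡n t≤V)) (sym (upToI j≤i)))

    consecutive : ∀ {i} → i < ℓ → ConsecutiveUpTo i
    consecutive {zero}  _     z≤n = trans a≡t (sym (+-identityʳ t))
    consecutive {suc i} 1+i<ℓ j≤1+i with m≤n⇒m<n∨m≡n j≤1+i
    ... | inj₁ j<1+i = upToI (s≤s⁻¹ j<1+i)
      where upToI = consecutive (<-trans (n<1+n i) 1+i<ℓ)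
    ... | inj₂ refl  = ≤-antisym (noJump 1+i<ℓ upToI) (noGap 1+i<ℓ upToI)
      where upToI = consecutive (<-trans (n<1+n i) 1+i<ℓ)

    t+ℓ≤n : t + ℓ ≤ n
    t+ℓ≤n = subst (λ m → t + m ≤ n) (suc-pred ℓ)
              (subst (_≤ n) (trans (cong suc (consecutive q<ℓ ≤-refl)) (sym (+-suc t q))) (Fin.toℕ<n (σ^ q a)))
      where
      instance _ = >-nonZero positive
      q = pred ℓ
      q<ℓ : q < ℓ
      q<ℓ = subst (q <_) (suc-pred ℓ) (n<1+n q)

    extend : ActsAsBlocks σ (c ++ ℓ ∷ []) 0
    extend x k x≡k k<sum with blockView t k
    ... | inside k<t = trans (acts x k x≡k k<t) (sym (blockSucc-++ˡ c (ℓ ∷ []) k<t))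
    ... | beyond i   = begin
      toℕ (lookup σ x)                ≡⟨ cong (toℕ ∘ lookup σ) x≡σⁱa ⟩
      toℕ (lookup σ (σ^ i a))         ≡⟨ cong toℕ (iterate-suc (lookup σ) a i) ⟨
      toℕ (σ^ (suc i) a)              ≡⟨ nextInCycle ⟩
      t + cyclicSucc ℓ i              ≡⟨ cong (t +_) (blockSucc-inside [] i<ℓ) ⟨
      t + blockSucc (ℓ ∷ []) i        ≡⟨ blockSucc-++ʳ c (ℓ ∷ []) i ⟨
      blockSucc (c ++ ℓ ∷ []) (t + i) ∎
      where
      i<ℓ : i < ℓ
      i<ℓ = +-cancelˡ-< t i ℓ (subst (t + i <_) (trans (sum-++ c (ℓ ∷ [])) (cong (t +_) (+-identityʳ ℓ))) k<sum)
      x≡σⁱa : x ≡ σ^ i a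
      x≡σⁱa = Fin.toℕ-injective (trans x≡k (sym (consecutive i<ℓ ≤-refl)))
      nextInCycle : toℕ (σ^ (suc i) a) ≡ t + cyclicSucc ℓ i
      nextInCycle with m≤n⇒m<n∨m≡n i<ℓ
      ... | inj₁ 1+i<ℓ = trans (consecutive 1+i<ℓ ≤-refl) (cong (t +_) (sym (cyclicSucc-< 1+i<ℓ)))
      ... | inj₂ 1+i≡ℓ = begin
        toℕ (σ^ (suc i) a)   ≡⟨ cong (λ k → toℕ (σ^ k a)) 1+i≡ℓ ⟩
        toℕ (σ^ ℓ a)         ≡⟨ cong toℕ returns ⟩
        toℕ a                ≡⟨ a≡t ⟩
        t                    ≡⟨ +-identityʳ t ⟨
        t + 0                ≡⟨ cong (t +_) (trans (sym (cyclicSucc-last i)) (cong (λ p → cyclicSucc p i) 1+i≡ℓ)) ⟩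
        t + cyclicSucc ℓ i   ∎

  decompose : ∀ c → All (2 ≤_) c → ActsAsBlocks σ c 0 → sum c ≤ n → Acc _<_ (n ∸ sum c) →
              ∃ λ c′ → Composition≥2 n c′ × ActsAsBlocks σ c′ 0
  decompose c parts≥2 acts sum≤n (acc rec) with sum c <? n
  ... | no  sum≮n = c , (parts≥2 , ≤-antisym sum≤n (≮⇒≥ sum≮n)) , acts
  ... | yes sum<n with minimalPeriod σ-injective (fromℕ< sum<n)
  ...   | ℓ , ℓ≤n , period =
    decompose (c ++ ℓ ∷ []) (All.++⁺ parts≥2 (2≤ℓ ∷ [])) extend sum′≤n
              (rec (∸-monoʳ-< (subst (sum c <_) (sym sum≡) (m<m+n (sum c) (<-trans z<s 2≤ℓ))) sum′≤n))
    where
    open NextBlock {c} acts sum<n ℓ≤n period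
    sum≡ : sum (c ++ ℓ ∷ []) ≡ sum c + ℓ
    sum≡ = trans (sum-++ c (ℓ ∷ [])) (cong (sum c +_) (+-identityʳ ℓ))
    sum′≤n : sum (c ++ ℓ ∷ []) ≤ n
    sum′≤n = subst (_≤ n) (sym sum≡) t+ℓ≤n

  σ≡blockPerm : ∃ λ c → Composition≥2 n c × σ ≡ blockPerm c
  σ≡blockPerm with decompose [] [] (λ _ _ _ ()) z≤n (<-wellFounded n)
  ... | c , comp@(_ , sum≡n) , acts = c , comp , (begin
    σ                               ≡⟨ tabulate∘lookup σ ⟨
    tabulate (lookup σ)             ≡⟨ tabulate-cong sameValues ⟩
    tabulate (lookup (blockPerm c)) ≡⟨ tabulate∘lookup (blockPerm c) ⟩
    blockPerm c                     ∎)
    where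
    sameValues : ∀ x → lookup σ x ≡ lookup (blockPerm c) x
    sameValues x = Fin.toℕ-injective
      (trans (acts x (toℕ x) refl (toℕ<sum c sum≡n x)) (sym (toℕ-lookup-blockPerm c sum≡n x)))

allVecs-unique : ∀ k m → Unique (allVecs k m)
allVecs-unique zero    m = [] ∷ []
allVecs-unique (suc k) m = subst Unique (sym (concatMap-map≡cartesianProductWith Vec._∷_ (allFin m) (allVecs k m)))
  (Unique.cartesianProductWith⁺ Vec._∷_ Vec.∷-injective (Unique.allFin⁺ m) (allVecs-unique k m))

∈-allVecs : ∀ {k m} (v : Vec (Fin m) k) → v ∈ allVecs k m
∈-allVecs Vec.[]                  = here refl
∈-allVecs {suc k} {m} (x Vec.∷ v) =
  subst (x Vec.∷ v ∈_) (sym (concatMap-map≡cartesianProductWith Vec._∷_ (allFin m) (allVecs k m)))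
    (∈-cartesianProductWith⁺ Vec._∷_ (∈-allFin x) (∈-allVecs v))

bumpHead : List ℕ → List ℕ
bumpHead []      = []
bumpHead (p ∷ c) = suc p ∷ c

bumpHead-injective : ∀ {c c′} → bumpHead c ≡ bumpHead c′ → c ≡ c′
bumpHead-injective {[]}    {[]}     _  = refl
bumpHead-injective {p ∷ c} {p′ ∷ c′} eq with refl , refl ← ∷-injective eq = refl

compositions≥2 : ℕ → List (List ℕ)
compositions≥2 zero          = [] ∷ []
compositions≥2 (suc zero)    = []
compositions≥2 (suc (suc k)) = map (2 ∷_) (compositions≥2 k) ++ map bumpHead (compositions≥2 (suc k))

∈-compositions≥2⁻ : ∀ k {c} → c ∈ compositions≥2 k → Composition≥2 k c
∈-compositions≥2⁻ zero          (here refl) = [] , refl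
∈-compositions≥2⁻ (suc (suc k)) {c} c∈ =
  [ headTwo (∈-compositions≥2⁻ k) , headBumped (∈-compositions≥2⁻ (suc k)) ]′
    (∈-++⁻ (map (2 ∷_) (compositions≥2 k)) c∈)
  where
  headTwo : (∀ {c′} → c′ ∈ compositions≥2 k → Composition≥2 k c′) →
            c ∈ map (2 ∷_) (compositions≥2 k) → Composition≥2 (2 + k) c
  headTwo valid c∈₁ with ∈-map⁻ (2 ∷_) c∈₁
  ... | c′ , c′∈ , refl = let parts≥2 , sum≡ = valid c′∈ in ≤-refl ∷ parts≥2 , cong (2 +_) sum≡
  headBumped : (∀ {c′} → c′ ∈ compositions≥2 (suc k) → Composition≥2 (suc k) c′) →
               c ∈ map bumpHead (compositions≥2 (suc k)) → Composition≥2 (2 + k) c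
  headBumped valid c∈₂ with ∈-map⁻ bumpHead c∈₂
  ... | c′ , c′∈ , refl with c′ | valid c′∈
  ...   | p ∷ r | 2≤p ∷ parts≥2 , sum≡ = m≤n⇒m≤1+n 2≤p ∷ parts≥2 , cong suc sum≡

∈-compositions≥2⁺ : ∀ k {c} → Composition≥2 k c → c ∈ compositions≥2 k
∈-compositions≥2⁺ zero          ([] , refl)                        = here refl
∈-compositions≥2⁺ zero          (s≤s _ ∷ _ , ())
∈-compositions≥2⁺ (suc zero)    (s≤s (s≤s _) ∷ _ , ())
∈-compositions≥2⁺ (suc (suc k)) (s≤s (s≤s {n = zero} _) ∷ parts≥2 , sum≡) =
  ∈-++⁺ˡ (∈-map⁺ (2 ∷_) (∈-compositions≥2⁺ k (parts≥2 , suc-injective (suc-injective sum≡))))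
∈-compositions≥2⁺ (suc (suc k)) {suc (suc (suc q)) ∷ r} (_ ∷ parts≥2 , sum≡) =
  ∈-++⁺ʳ (map (2 ∷_) (compositions≥2 k))
    (∈-map⁺ bumpHead (∈-compositions≥2⁺ (suc k) (s≤s (s≤s z≤n) ∷ parts≥2 , suc-injective sum≡)))

compositions≥2-unique : ∀ k → Unique (compositions≥2 k)
compositions≥2-unique zero          = [] ∷ []
compositions≥2-unique (suc zero)    = []
compositions≥2-unique (suc (suc k)) =
  Unique.++⁺ (Unique.map⁺ (proj₂ ∘ ∷-injective) (compositions≥2-unique k))
             (Unique.map⁺ bumpHead-injective (compositions≥2-unique (suc k)))
             headsDiffer
  where
  headsDiffer : ∀ {c} → ¬ (c ∈ map (2 ∷_) (compositions≥2 k) × c ∈ map bumpHead (compositions≥2 (suc k)))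
  headsDiffer (c∈₁ , c∈₂) with ∈-map⁻ (2 ∷_) c∈₁ | ∈-map⁻ bumpHead c∈₂
  ... | _ , _ , refl | p ∷ _ , c′∈ , eq with ∈-compositions≥2⁻ (suc k) c′∈
  ...   | 2≤p ∷ _ , _ = <⇒≢ (s≤s 2≤p) (proj₁ (∷-injective eq))

D13-2↭blockPerms : ∀ n → D13-2 n ↭ map (blockPerm {n}) (compositions≥2 n)
D13-2↭blockPerms n = ∼bag⇒↭ (unique∧set⇒bag
  (Unique.filter⁺ InD13-2? (allVecs-unique n n))
  (map⁺-injectiveOn (λ c∈ c′∈ → blockPerm-injective (∈-compositions≥2⁻ n c∈) (∈-compositions≥2⁻ n c′∈))
                    (compositions≥2-unique n))
  (mk⇔ toBlockPerm fromBlockPerm))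
  where
  toBlockPerm : ∀ {σ} → σ ∈ D13-2 n → σ ∈ map blockPerm (compositions≥2 n)
  toBlockPerm {σ} σ∈ with proj₂ (∈-filter⁻ InD13-2? {xs = allVecs n n} σ∈)
  ... | σ-injective , noFix , avoids with Decomposition.σ≡blockPerm σ σ-injective noFix avoids
  ...   | c , comp , refl = ∈-map⁺ blockPerm (∈-compositions≥2⁺ n comp)
  fromBlockPerm : ∀ {σ} → σ ∈ map blockPerm (compositions≥2 n) → σ ∈ D13-2 n
  fromBlockPerm σ∈ with ∈-map⁻ blockPerm σ∈
  ... | c , c∈ , refl =
    ∈-filter⁺ InD13-2? (∈-allVecs (blockPerm c)) (BlockPerm.blockPerm-∈D13-2 (∈-compositions≥2⁻ n c∈))

cyclePoly-compositions≥2 : ∀ n y → cyclePoly n y ≡ sum (map (λ c → y ^ length c) (compositions≥2 n))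
cyclePoly-compositions≥2 n y = begin
  sum (map (λ σ → y ^ μ σ) (D13-2 n))                          ≡⟨ sum-↭ (↭.map⁺ (λ σ → y ^ μ σ) (D13-2↭blockPerms n)) ⟩
  sum (map (λ σ → y ^ μ σ) (map blockPerm (compositions≥2 n))) ≡⟨ cong sum (map-∘ (compositions≥2 n)) ⟨
  sum (map (λ c → y ^ μ (blockPerm {n} c)) (compositions≥2 n)) ≡⟨ cong sum (map-cong-local (All.tabulate μ≡)) ⟩
  sum (map (λ c → y ^ length c) (compositions≥2 n))            ∎
  where
  μ≡ : ∀ {c} → c ∈ compositions≥2 n → y ^ μ (blockPerm {n} c) ≡ y ^ length c
  μ≡ c∈ = cong (y ^_) (BlockPerm.μ-blockPerm (∈-compositions≥2⁻ n c∈))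

compositions≥2-poly-rec : ∀ k y →
  sum (map (λ c → y ^ length c) (compositions≥2 (2 + k))) ≡
  y * sum (map (λ c → y ^ length c) (compositions≥2 k)) + sum (map (λ c → y ^ length c) (compositions≥2 (1 + k)))
compositions≥2-poly-rec k y = begin
  sum (map F (map (2 ∷_) A ++ map bumpHead B))              ≡⟨ cong sum (map-++ F (map (2 ∷_) A) (map bumpHead B)) ⟩
  sum (map F (map (2 ∷_) A) ++ map F (map bumpHead B))      ≡⟨ sum-++ (map F (map (2 ∷_) A)) _ ⟩
  sum (map F (map (2 ∷_) A)) + sum (map F (map bumpHead B)) ≡⟨ cong₂ _+_ (cong sum (map-∘ A)) (cong sum (map-∘ B)) ⟨
  sum (map (λ c → y * F c) A) + sum (map (F ∘ bumpHead) B)  ≡⟨ cong₂ _+_ (sum-map-*ˡ y F A)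
                                                                 (cong sum (map-cong (cong (y ^_) ∘ length-bumpHead) B)) ⟩
  y * sum (map F A) + sum (map F B)                         ∎
  where
  F = λ (c : List ℕ) → y ^ length c
  A = compositions≥2 k
  B = compositions≥2 (suc k)
  length-bumpHead : ∀ c → length (bumpHead c) ≡ length c
  length-bumpHead []      = refl
  length-bumpHead (_ ∷ _) = refl

binomialTerm : ℕ → ℕ → ℕ → ℕ
binomialTerm y k i = ((k ∸ i) C i) * y ^ i

f-upTo : ∀ k y {N} → suc (k / 2) ≤ N → f k y ≡ sum (map (binomialTerm y k) (upTo N))
f-upTo k y N≥ = sym (sum-map-upTo-vanishing (binomialTerm y k) vanish N≥)
  where
  vanish : ∀ {i} → suc (k / 2) ≤ i → binomialTerm y k i ≡ 0
  vanish {i@(suc _)} i>k/2 = cong (_* y ^ i) (k>n⇒nCk≡0 (m<n+o⇒m∸n<o k i k<i+i))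
    where
    k<2+[k/2]*2 : k < 2 + (k / 2) * 2
    k<2+[k/2]*2 = subst (_< 2 + (k / 2) * 2) (sym (m≡m%n+[m/n]*n k 2)) (+-monoˡ-< ((k / 2) * 2) (m%n<n k 2))
    k<i+i : k < i + i
    k<i+i = <-≤-trans k<2+[k/2]*2 (subst₂ _≤_ (trans (*-suc 2 (k / 2)) (cong (2 +_) (*-comm 2 (k / 2))))
                                                (cong (i +_) (+-identityʳ i)) (*-monoʳ-≤ 2 i>k/2))

pascal-diagonal : ∀ k i → (suc k ∸ i) C suc i ≡ (k ∸ i) C i + (k ∸ i) C suc i
pascal-diagonal k i with i ≤? k
... | yes i≤k = trans (cong (_C suc i) (+-∸-assoc 1 i≤k)) (sym (nCk+nC[k+1]≡[n+1]C[k+1] (k ∸ i) i))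
... | no  i≰k with ≰⇒> i≰k
...   | k<i@(s≤s _) rewrite m≤n⇒m∸n≡0 k<i | m≤n⇒m∸n≡0 (<⇒≤ k<i) = refl

binomialTerm-rec : ∀ y k i → binomialTerm y (2 + k) (suc i) ≡ binomialTerm y (1 + k) (suc i) + y * binomialTerm y k i
binomialTerm-rec y k i rewrite pascal-diagonal k i = distrib ((k ∸ i) C i) ((k ∸ i) C suc i) y (y ^ i)
  where
  distrib : ∀ a b y z → (a + b) * (y * z) ≡ b * (y * z) + y * (a * z)
  distrib = solve-∀

f-rec : ∀ k y → f (2 + k) y ≡ f (1 + k) y + y * f k y
f-rec k y = begin
  f (2 + k) y                                         ≡⟨ f-upTo (2 + k) y (s≤s (m/n≤m (2 + k) 2)) ⟩
  ∑ T₂ (3 + k)                                        ≡⟨ sum-map-upTo-suc T₂ (2 + k) ⟩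
  T₂ 0 + ∑ (T₂ ∘ suc) (2 + k)                         ≡⟨ cong (λ ts → T₂ 0 + sum ts) (map-cong (binomialTerm-rec y k) is) ⟩
  T₂ 0 + ∑ (λ i → T₁ (suc i) + y * T₀ i) (2 + k)      ≡⟨ cong (T₂ 0 +_) (sum-map-+ (T₁ ∘ suc) (λ i → y * T₀ i) is) ⟩
  T₂ 0 + (∑ (T₁ ∘ suc) (2 + k) + ∑ (λ i → y * T₀ i) (2 + k))
                                                      ≡⟨ +-assoc (T₁ 0) (∑ (T₁ ∘ suc) (2 + k)) _ ⟨
  T₁ 0 + ∑ (T₁ ∘ suc) (2 + k) + ∑ (λ i → y * T₀ i) (2 + k)
                                                      ≡⟨ cong₂ _+_ (sum-map-upTo-suc T₁ (2 + k)) (sym (sum-map-*ˡ y T₀ is)) ⟨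
  ∑ T₁ (3 + k) + y * ∑ T₀ (2 + k)                     ≡⟨ cong₂ (λ u v → u + y * v)
                                                           (f-upTo (1 + k) y (s≤s (m≤n⇒m≤1+n (m/n≤m (1 + k) 2))))
                                                           (f-upTo k y (s≤s (m≤n⇒m≤1+n (m/n≤m k 2)))) ⟨
  f (1 + k) y + y * f k y                             ∎
  where
  ∑ : (ℕ → ℕ) → ℕ → ℕ
  ∑ g N = sum (map g (upTo N))
  is = upTo (2 + k)
  T₀ = binomialTerm y k
  T₁ = binomialTerm y (1 + k)
  T₂ = binomialTerm y (2 + k)

compositions≥2-poly : ∀ k y → sum (map (λ c → y ^ length c) (compositions≥2 (2 + k))) ≡ y * f k y
compositions≥2-poly zero          y = +-identityʳ (y * 1)
compositions≥2-poly (suc zero)    y = +-identityʳ (y * 1)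
compositions≥2-poly (suc (suc k)) y = begin
  G (4 + k)                         ≡⟨ compositions≥2-poly-rec (2 + k) y ⟩
  y * G (2 + k) + G (3 + k)         ≡⟨ cong₂ (λ u v → y * u + v) (compositions≥2-poly k y) (compositions≥2-poly (suc k) y) ⟩
  y * (y * f k y) + y * f (1 + k) y ≡⟨ +-comm (y * (y * f k y)) _ ⟩
  y * f (1 + k) y + y * (y * f k y) ≡⟨ *-distribˡ-+ y (f (1 + k) y) _ ⟨
  y * (f (1 + k) y + y * f k y)     ≡⟨ cong (y *_) (f-rec k y) ⟨
  y * f (2 + k) y                   ∎
  where
  G = λ m → sum (map (λ c → y ^ length c) (compositions≥2 m))

proposition2p1 : (n : ℕ) → 2 ≤ n → (y : ℕ) → cyclePoly n y ≡ y * f (n ∸ 2) y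
proposition2p1 (suc (suc k)) _        y = trans (cyclePoly-compositions≥2 (2 + k) y) (compositions≥2-poly k y)
proposition2p1 (suc zero)    (s≤s ()) y
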